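{- Let the Fibonacci triangle $\mathcal{F}$ be defined as follows. Each row $n\ge1$ is a finite sequence of positive integers together with a partition of it into groups of consecutive entries, each group having two or three entries. Row $1$ is $1,1$, forming a single group. Row $n+1$ is obtained from row $n$ as follows: imagine a $0$ placed before the first entry of row $n$, regarded as the last element of a group, and a $0$ placed after the last entry, regarded as the first element of a group. Reading left to right, for each pair of consecutive entries $a_j,a_{j+1}$ (possibly involving these imagined $0$'s) such that $a_j$ ends a group and $a_{j+1}$ begins a group, write the $3$-element group $a_j,\,a_j+a_{j+1},\,a_{j+1}$; for each entry $a_j$ which is the middle element of a $3$-element group, write the $2$-element group $a_j,a_j$; finally delete the two $0$'s arising from the imagined $0$'s (so the first and last groups of row $n+1$ become $2$-element groups). (Thus rows $2,3,4$ are $1,1\,|\,1,1$; $1,1\,|\,1,2,1\,|\,1,1$; $1,1\,|\,1,2,1\,|\,2,2\,|\,1,2,1\,|\,1,1$.) Let $\langle n,k\rangle$ denote the $k$th entry ($k\ge0$) of row $n$, and $H_n(x)=\sum_{k\ge0}\langle n,k\rangle x^k$. Then for all $n\ge1$, $$H_n(x)=\prod_{i=1}^n\left(1+x^{F_{i+1}}\right),$$ where $F_j$ are the Fibonacci numbers with $F_1=F_2=1$. -}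

module Defs where

open import Data.Nat using (ℕ; zero; suc; _+_; _*_)
open import Data.List using (List; []; _∷_; _++_; map; replicate; concat)

fib : ℕ → ℕ
fib zero = 0
fib (suc zero) = 1
fib (suc (suc n)) = fib n + fib (suc n)

-- The Fibonacci triangle.  A row is a list of groups (each a list of
-- consecutive entries); the row itself is the concatenation.

Group : Set
Group = List ℕ

Row : Set
Row = List Group

-- first / last entry of a group (groups are never empty; 0 is a dummy)
firstE : Group → ℕ
firstE [] = 0
firstE (x ∷ _) = x

lastE : Group → ℕ
lastE [] = 0
lastE (x ∷ []) = x
lastE (_ ∷ y ∷ ys) = lastE (y ∷ ys)

midGroups : Group → Row
midGroups (a ∷ b ∷ c ∷ []) = (b ∷ b ∷ []) ∷ []
midGroups _ = []

-- 'prev' is the last element of the previous group (initially the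
-- imagined 0 before the row); at the end, the imagined 0 after the row
-- is the first element of a group.
go : ℕ → Row → Row
go prev [] = (prev ∷ prev + 0 ∷ 0 ∷ []) ∷ []
go prev (g ∷ gs) =
  (prev ∷ prev + firstE g ∷ firstE g ∷ []) ∷ (midGroups g ++ go (lastE g) gs)

dropFirst : Group → Group
dropFirst [] = []
dropFirst (_ ∷ xs) = xs

dropLast : Group → Group
dropLast [] = []
dropLast (_ ∷ []) = []
dropLast (x ∷ y ∷ ys) = x ∷ dropLast (y ∷ ys)

trimLast : Row → Row
trimLast [] = []
trimLast (g ∷ []) = dropLast g ∷ []
trimLast (g ∷ h ∷ gs) = g ∷ trimLast (h ∷ gs)

trim : Row → Row
trim [] = []
trim (g ∷ gs) = trimLast (dropFirst g ∷ gs)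

nextRow : Row → Row
nextRow r = trim (go 0 r)

-- row n of the triangle, for n ≥ 1 (row 0 is a dummy and never used)
row : ℕ → Row
row zero = []
row (suc zero) = (1 ∷ 1 ∷ []) ∷ []
row (suc (suc n)) = nextRow (row (suc n))

-- Polynomials with ℕ coefficients as coefficient lists (constant first).

Poly : Set
Poly = List ℕ

coeff : Poly → ℕ → ℕ
coeff [] _ = 0
coeff (a ∷ p) zero = a
coeff (a ∷ p) (suc k) = coeff p k

_+P_ : Poly → Poly → Poly
[] +P q = q
(a ∷ p) +P [] = a ∷ p
(a ∷ p) +P (b ∷ q) = (a + b) ∷ (p +P q)

_*P_ : Poly → Poly → Poly
[] *P q = []
(a ∷ p) *P q = map (a *_) q +P (0 ∷ (p *P q))

xPow : ℕ → Poly
xPow m = replicate m 0 ++ (1 ∷ [])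

fibProd : ℕ → Poly
fibProd zero = 1 ∷ []
fibProd (suc n) = fibProd n *P ((1 ∷ []) +P xPow (fib (suc (suc n))))

entry : ℕ → ℕ → ℕ
entry n k = coeff (concat (row n)) k

-- A row is a concatenation of segments: what the construction grows out of a
-- group a, b in j steps depends only on j, a and b, and row n + 1 consists of
-- the segments j = 0, 1, …, n, …, 1, 0 grown out of groups 1, 1.  On the other
-- side, the finite products are palindromic and fix the coefficients R k of
-- x · ∏ (1 + x^F_(i+1)) one after another; with H_(m+1) = H_m + x^F_(m+2) H_m
-- this gives R (F_(m+2) + k) = R i + R k whenever i + k = F_(m+1).  By that
-- identity the entry of segment j a b at position k is a R i + b R k, where
-- i + k = F_(j+1).  So the first F_(n+3) − 1 entries of row n + 1 are stable
-- coefficients of the product, and its remaining entries repeat the end of row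
-- n, just as H_(n+1) repeats H_n shifted by F_(n+2) beyond the degree of H_n.
module Submission where

open import Defs
open import Data.Nat
  using (ℕ; zero; suc; _+_; _*_; _≤_; _<_; _≤′_; ≤′-reflexive; ≤′-step; z≤n; s≤s)
open import Data.Nat.Properties
open import Data.Nat.Tactic.RingSolver using (solve-∀)
open import Data.List
  using (List; []; _∷_; _++_; map; replicate; length; concat; concatMap; foldl; upTo; downFrom)
open import Data.List.Properties
  using ( ++-assoc; ++-identityʳ; length-++; concat-++; concatMap-++; foldl-++; map-++
        ; map-applyUpTo; applyUpTo-∷ʳ; map-applyDownFrom; applyDownFrom-∷ʳ)
open import Data.Product using (_,_)
open import Data.Sum using (inj₁; inj₂)
open import Data.Empty using (⊥-elim)
open import Relation.Binary.PropositionalEquality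
open ≡-Reasoning

shift : ℕ → Poly → Poly
shift n p = replicate n 0 ++ p

coeff-++ˡ : ∀ p q {n k} → length p ≡ n → k < n → coeff (p ++ q) k ≡ coeff p k
coeff-++ˡ (a ∷ p) q {k = zero}  refl _         = refl
coeff-++ˡ (a ∷ p) q {k = suc k} refl (s≤s k<p) = coeff-++ˡ p q refl k<p

coeff-++ʳ : ∀ p q {n} → length p ≡ n → ∀ k → coeff (p ++ q) (n + k) ≡ coeff q k
coeff-++ʳ []      q refl k = refl
coeff-++ʳ (a ∷ p) q refl k = coeff-++ʳ p q refl k

coeff-shift-< : ∀ n p {k} → k < n → coeff (shift n p) k ≡ 0
coeff-shift-< (suc n) p {zero}  _         = refl
coeff-shift-< (suc n) p {suc k} (s≤s k<n) = coeff-shift-< n p k<n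

coeff-shift-+ : ∀ n p k → coeff (shift n p) (n + k) ≡ coeff p k
coeff-shift-+ zero    p k = refl
coeff-shift-+ (suc n) p k = coeff-shift-+ n p k

coeff-∷-cong : ∀ a {p q} → coeff p ≗ coeff q → coeff (a ∷ p) ≗ coeff (a ∷ q)
coeff-∷-cong a p≗q zero    = refl
coeff-∷-cong a p≗q (suc k) = p≗q k

coeff-+P : ∀ p q k → coeff (p +P q) k ≡ coeff p k + coeff q k
coeff-+P []      q       k       = refl
coeff-+P (a ∷ p) []      k       = sym (+-identityʳ _)
coeff-+P (a ∷ p) (b ∷ q) zero    = refl
coeff-+P (a ∷ p) (b ∷ q) (suc k) = coeff-+P p q k

coeff-map-* : ∀ a p k → coeff (map (a *_) p) k ≡ a * coeff p k
coeff-map-* a []      k       = sym (*-zeroʳ a)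
coeff-map-* a (b ∷ p) zero    = refl
coeff-map-* a (b ∷ p) (suc k) = coeff-map-* a p k

coeff-*P-∷ : ∀ a p q k → coeff ((a ∷ p) *P q) k ≡ a * coeff q k + coeff (0 ∷ p *P q) k
coeff-*P-∷ a p q k = trans (coeff-+P (map (a *_) q) _ k) (cong (_+ _) (coeff-map-* a q k))

coeff-*P-+P : ∀ p q r → coeff (p *P (q +P r)) ≗ coeff ((p *P q) +P (p *P r))
coeff-*P-+P []      q r k = refl
coeff-*P-+P (a ∷ p) q r k = begin
  coeff ((a ∷ p) *P (q +P r)) k
    ≡⟨ coeff-*P-∷ a p (q +P r) k ⟩
  a * coeff (q +P r) k + coeff (0 ∷ p *P (q +P r)) k
    ≡⟨ cong₂ (λ u v → a * u + v) (coeff-+P q r k) (coeff-∷-cong 0 (coeff-*P-+P p q r) k) ⟩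
  a * (coeff q k + coeff r k) + coeff ((0 ∷ p *P q) +P (0 ∷ p *P r)) k
    ≡⟨ cong (a * _ +_) (coeff-+P (0 ∷ p *P q) (0 ∷ p *P r) k) ⟩
  a * (coeff q k + coeff r k) + (coeff (0 ∷ p *P q) k + coeff (0 ∷ p *P r) k)
    ≡⟨ interchange a (coeff q k) (coeff r k) _ _ ⟩
  (a * coeff q k + coeff (0 ∷ p *P q) k) + (a * coeff r k + coeff (0 ∷ p *P r) k)
    ≡⟨ cong₂ _+_ (coeff-*P-∷ a p q k) (coeff-*P-∷ a p r k) ⟨
  coeff ((a ∷ p) *P q) k + coeff ((a ∷ p) *P r) k
    ≡⟨ coeff-+P ((a ∷ p) *P q) _ k ⟨
  coeff (((a ∷ p) *P q) +P ((a ∷ p) *P r)) k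
    ∎
  where
  interchange : ∀ a q r x y → a * (q + r) + (x + y) ≡ (a * q + x) + (a * r + y)
  interchange = solve-∀

coeff-*P-0∷ : ∀ p q → coeff (p *P (0 ∷ q)) ≗ coeff (0 ∷ p *P q)
coeff-*P-0∷ []      q zero    = refl
coeff-*P-0∷ []      q (suc k) = refl
coeff-*P-0∷ (a ∷ p) q zero    = cong (_+ 0) (*-zeroʳ a)
coeff-*P-0∷ (a ∷ p) q (suc k) = begin
  coeff (map (a *_) q +P (p *P (0 ∷ q))) k          ≡⟨ coeff-+P (map (a *_) q) _ k ⟩
  coeff (map (a *_) q) k + coeff (p *P (0 ∷ q)) k   ≡⟨ cong (_ +_) (coeff-*P-0∷ p q k) ⟩
  coeff (map (a *_) q) k + coeff (0 ∷ p *P q) k     ≡⟨ coeff-+P (map (a *_) q) _ k ⟨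
  coeff ((a ∷ p) *P q) k                            ∎

coeff-*P-xPow : ∀ p n → coeff (p *P xPow n) ≗ coeff (shift n p)
coeff-*P-xPow []      zero    k       = refl
coeff-*P-xPow (a ∷ p) zero    zero    = trans (+-identityʳ _) (*-identityʳ a)
coeff-*P-xPow (a ∷ p) zero    (suc k) = coeff-*P-xPow p zero k
coeff-*P-xPow p       (suc n) k       =
  trans (coeff-*P-0∷ p (xPow n) k) (coeff-∷-cong 0 (coeff-*P-xPow p n) k)

fib-pos : ∀ n → 0 < fib (suc n)
fib-pos zero    = s≤s z≤n
fib-pos (suc n) = ≤-trans (fib-pos n) (m≤n+m (fib (suc n)) (fib n))

fib-≤-suc : ∀ n → fib n ≤ fib (suc n)
fib-≤-suc zero    = z≤n
fib-≤-suc (suc n) = m≤n+m (fib (suc n)) (fib n)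

fib-mono-≤ : ∀ {m n} → m ≤ n → fib m ≤ fib n
fib-mono-≤ m≤n = fib-mono-≤′ (≤⇒≤′ m≤n)
  where
  fib-mono-≤′ : ∀ {m n} → m ≤′ n → fib m ≤ fib n
  fib-mono-≤′ (≤′-reflexive refl) = ≤-refl
  fib-mono-≤′ (≤′-step {n} m≤′n) = ≤-trans (fib-mono-≤′ m≤′n) (fib-≤-suc n)

fib-< : ∀ n → fib (2 + n) < fib (3 + n)
fib-< n = m<n+m (fib (2 + n)) (fib-pos n)

n<fib : ∀ n → n < fib (2 + n)
n<fib zero    = s≤s z≤n
n<fib (suc n) = +-mono-≤ (fib-pos n) (n<fib n)

data Split (n k : ℕ) : Set where
  below : ∀ i → suc i + k ≡ n → Split n k
  above : ∀ r → k ≡ n + r → Split n k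

split : ∀ n k → Split n k
split zero    k       = above k refl
split (suc n) zero    = below n (cong suc (+-identityʳ n))
split (suc n) (suc k) with split n k
... | below i eq = below i (trans (cong suc (+-suc i k)) (cong suc eq))
... | above r eq = above r (cong suc eq)

1+i+k≡n⇒i<n : ∀ {i k n} → suc i + k ≡ n → i < n
1+i+k≡n⇒i<n {i} {k} eq = ≤-trans (s≤s (m≤m+n i k)) (≤-reflexive eq)

1+i+k≡n⇒k<n : ∀ {i k n} → suc i + k ≡ n → k < n
1+i+k≡n⇒k<n {i} {k} eq = ≤-trans (s≤s (m≤n+m k i)) (≤-reflexive eq)

fibCoeff : ℕ → ℕ → ℕ
fibCoeff m = coeff (fibProd m)

fibCoeff-suc : ∀ m k → fibCoeff (suc m) k ≡ fibCoeff m k + coeff (shift (fib (2 + m)) (fibProd m)) k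
fibCoeff-suc m k = begin
  coeff (P *P ((1 ∷ []) +P xPow F)) k             ≡⟨ coeff-*P-+P P (1 ∷ []) (xPow F) k ⟩
  coeff ((P *P xPow 0) +P (P *P xPow F)) k        ≡⟨ coeff-+P (P *P xPow 0) _ k ⟩
  coeff (P *P xPow 0) k + coeff (P *P xPow F) k   ≡⟨ cong₂ _+_ (coeff-*P-xPow P 0 k) (coeff-*P-xPow P F k) ⟩
  coeff P k + coeff (shift F P) k                 ∎
  where
  P = fibProd m
  F = fib (2 + m)

fibCoeff-suc-< : ∀ m {k} → k < fib (2 + m) → fibCoeff (suc m) k ≡ fibCoeff m k
fibCoeff-suc-< m {k} k<F = begin
  fibCoeff (suc m) k                             ≡⟨ fibCoeff-suc m k ⟩
  fibCoeff m k + coeff (shift F (fibProd m)) k   ≡⟨ cong (fibCoeff m k +_) (coeff-shift-< F (fibProd m) k<F) ⟩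
  fibCoeff m k + 0                               ≡⟨ +-identityʳ _ ⟩
  fibCoeff m k                                   ∎
  where F = fib (2 + m)

fibCoeff-suc-+ : ∀ m r → fibCoeff (suc m) (fib (2 + m) + r) ≡ fibCoeff m (fib (2 + m) + r) + fibCoeff m r
fibCoeff-suc-+ m r =
  trans (fibCoeff-suc m (F + r)) (cong (fibCoeff m (F + r) +_) (coeff-shift-+ F (fibProd m) r))
  where F = fib (2 + m)

fibCoeff-stable-≤ : ∀ {m n k} → m ≤ n → k < fib (2 + m) → fibCoeff n k ≡ fibCoeff m k
fibCoeff-stable-≤ {m} {k = k} m≤n k<F = stable (≤⇒≤′ m≤n)
  where
  stable : ∀ {n} → m ≤′ n → fibCoeff n k ≡ fibCoeff m k
  stable (≤′-reflexive refl) = refl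
  stable (≤′-step {n} m≤′n)  =
    trans (fibCoeff-suc-< n (≤-trans k<F (fib-mono-≤ (s≤s (s≤s (≤′⇒≤ m≤′n)))))) (stable m≤′n)

-- The coefficient of x^k in ∏_(i ≥ 1) (1 + x^F_(i+1)), reached at m = k by fibCoeff-stable.
limitCoeff : ℕ → ℕ
limitCoeff k = fibCoeff k k

fibCoeff-stable : ∀ m {k} → k < fib (2 + m) → fibCoeff m k ≡ limitCoeff k
fibCoeff-stable m {k} k<F with ≤-total m k
... | inj₁ m≤k = sym (fibCoeff-stable-≤ m≤k k<F)
... | inj₂ k≤m = fibCoeff-stable-≤ k≤m (n<fib k)

fibCoeff-vanish : ∀ m {j} → fib (3 + m) ≤ suc j → fibCoeff m j ≡ 0
fibCoeff-vanish zero    {zero}  (s≤s ())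
fibCoeff-vanish zero    {suc j} _ = refl
fibCoeff-vanish (suc m) {j} F+G≤1+j with split (fib (2 + m)) j
... | below i eq = ⊥-elim (<⇒≱ (m<m+n F (fib-pos (2 + m))) F+G≤F)
  where
  F = fib (2 + m)
  F+G≤F : F + fib (3 + m) ≤ F
  F+G≤F = ≤-trans F+G≤1+j (≤-trans (s≤s (m≤n+m j i)) (≤-reflexive eq))
... | above r refl = begin
  fibCoeff (suc m) (F + r)            ≡⟨ fibCoeff-suc-+ m r ⟩
  fibCoeff m (F + r) + fibCoeff m r   ≡⟨ cong₂ _+_ (fibCoeff-vanish m (m+n≤o⇒n≤o F F+G≤1+j))
                                                   (fibCoeff-vanish m (+-cancelˡ-≤ F _ _ F+G≤F+1+r)) ⟩
  0                                   ∎
  where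
  F = fib (2 + m)
  F+G≤F+1+r : F + fib (3 + m) ≤ F + suc r
  F+G≤F+1+r = ≤-trans F+G≤1+j (≤-reflexive (sym (+-suc F r)))

fibCoeff-palindrome : ∀ m {i j} → 2 + i + j ≡ fib (3 + m) → fibCoeff m i ≡ fibCoeff m j
fibCoeff-suc-mirror : ∀ m {i s} → i < fib (2 + m) → 2 + i + s ≡ fib (3 + m) →
                      fibCoeff (suc m) i ≡ fibCoeff (suc m) (fib (2 + m) + s)

fibCoeff-palindrome zero    {zero}  {zero}  _  = refl
fibCoeff-palindrome zero    {zero}  {suc j} ()
fibCoeff-palindrome zero    {suc i} {j}     ()
fibCoeff-palindrome (suc m) {i} {j} eq with split (fib (2 + m)) i | split (fib (2 + m)) j
... | below a ea | below b eb = ⊥-elim (<-irrefl eq (≤-<-trans 2+i+j≤F+F (+-monoʳ-< F (fib-< m))))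
  where
  F = fib (2 + m)
  2+i+j≤F+F : 2 + i + j ≤ F + F
  2+i+j≤F+F = ≤-trans (≤-reflexive (cong suc (sym (+-suc i j))))
                      (+-mono-≤ (1+i+k≡n⇒k<n ea) (1+i+k≡n⇒k<n eb))
... | below a ea | above s refl =
  fibCoeff-suc-mirror m (1+i+k≡n⇒k<n ea) (+-cancelˡ-≡ F _ _ (trans (sym (rearrange i F s)) eq))
  where
  F = fib (2 + m)
  rearrange : ∀ i F s → 2 + i + (F + s) ≡ F + (2 + i + s)
  rearrange = solve-∀
... | above r refl | below b eb =
  sym (fibCoeff-suc-mirror m (1+i+k≡n⇒k<n eb) (+-cancelˡ-≡ F _ _ (trans (sym (rearrange F r j)) eq)))
  where
  F = fib (2 + m)
  rearrange : ∀ F r j → 2 + (F + r) + j ≡ F + (2 + j + r)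
  rearrange = solve-∀
... | above r refl | above s refl = begin
  fibCoeff (suc m) (F + r)            ≡⟨ fibCoeff-suc-+ m r ⟩
  fibCoeff m (F + r) + fibCoeff m r   ≡⟨ cong₂ _+_ (fibCoeff-palindrome m (cancel (rearrangeˡ F r s)))
                                                   (fibCoeff-palindrome m (cancel (rearrangeʳ F r s))) ⟩
  fibCoeff m s + fibCoeff m (F + s)   ≡⟨ +-comm (fibCoeff m s) _ ⟩
  fibCoeff m (F + s) + fibCoeff m s   ≡⟨ fibCoeff-suc-+ m s ⟨
  fibCoeff (suc m) (F + s)            ∎
  where
  F = fib (2 + m)
  cancel : ∀ {n} → 2 + (F + r) + (F + s) ≡ F + n → n ≡ fib (3 + m)
  cancel rearranged = +-cancelˡ-≡ F _ _ (trans (sym rearranged) eq)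
  rearrangeˡ : ∀ F r s → 2 + (F + r) + (F + s) ≡ F + (2 + (F + r) + s)
  rearrangeˡ = solve-∀
  rearrangeʳ : ∀ F r s → 2 + (F + r) + (F + s) ≡ F + (2 + r + (F + s))
  rearrangeʳ = solve-∀

fibCoeff-suc-mirror m {i} {s} i<F eq = begin
  fibCoeff (suc m) i                  ≡⟨ fibCoeff-suc-< m i<F ⟩
  fibCoeff m i                        ≡⟨ fibCoeff-palindrome m eq ⟩
  fibCoeff m s                        ≡⟨ cong (_+ fibCoeff m s) (fibCoeff-vanish m G≤1+F+s) ⟨
  fibCoeff m (F + s) + fibCoeff m s   ≡⟨ fibCoeff-suc-+ m s ⟨
  fibCoeff (suc m) (F + s)            ∎
  where
  F = fib (2 + m)
  G≤1+F+s : fib (3 + m) ≤ suc (F + s)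
  G≤1+F+s = ≤-trans (≤-reflexive (sym eq)) (s≤s (+-monoˡ-≤ s i<F))

-- The coefficients of x times the infinite product; the shift keeps predecessors
-- out of the split identity below.
xLimitCoeff : ℕ → ℕ
xLimitCoeff zero    = 0
xLimitCoeff (suc k) = limitCoeff k

xLimitCoeff-split : ∀ m {i k} → i + k ≡ fib (1 + m) →
                    xLimitCoeff (fib (2 + m) + k) ≡ xLimitCoeff i + xLimitCoeff k
xLimitCoeff-split m {zero}  {zero}  eq = ⊥-elim (<⇒≢ (fib-pos m) eq)
xLimitCoeff-split m {suc a} {zero}  eq with m≤n⇒∃[o]m+o≡n (fib-pos (1 + m))
... | b , 1+b≡F = begin
  xLimitCoeff (F + 0)   ≡⟨ cong xLimitCoeff (trans (+-identityʳ F) (sym 1+b≡F)) ⟩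
  limitCoeff b          ≡⟨ fibCoeff-stable m (≤-reflexive 1+b≡F) ⟨
  fibCoeff m b          ≡⟨ fibCoeff-palindrome m (trans (rearrange a b) (cong₂ _+_ eq 1+b≡F)) ⟩
  fibCoeff m a          ≡⟨ fibCoeff-stable m (≤-trans (1+i+k≡n⇒i<n eq) (fib-≤-suc (1 + m))) ⟩
  limitCoeff a          ≡⟨ +-identityʳ _ ⟨
  limitCoeff a + 0      ∎
  where
  F = fib (2 + m)
  rearrange : ∀ a b → 2 + b + a ≡ (suc a + 0) + (1 + b)
  rearrange = solve-∀
xLimitCoeff-split m {i}     {suc k} eq = begin
  xLimitCoeff (F + suc k)             ≡⟨ cong xLimitCoeff (+-suc F k) ⟩
  limitCoeff (F + k)                  ≡⟨ fibCoeff-stable (suc m) F+k<G ⟨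
  fibCoeff (suc m) (F + k)            ≡⟨ fibCoeff-suc-+ m k ⟩
  fibCoeff m (F + k) + fibCoeff m k   ≡⟨ cong₂ _+_ (mirrored i eq) (fibCoeff-stable m k<F) ⟩
  xLimitCoeff i + limitCoeff k        ∎
  where
  F = fib (2 + m)
  1+k≤F₁ : suc k ≤ fib (1 + m)
  1+k≤F₁ = m+n≤o⇒n≤o i (≤-reflexive eq)
  k<F : k < F
  k<F = ≤-trans 1+k≤F₁ (fib-≤-suc (1 + m))
  F+k<G : F + k < fib (3 + m)
  F+k<G = ≤-trans (≤-reflexive (sym (+-suc F k)))
                  (≤-trans (+-monoʳ-≤ F 1+k≤F₁) (≤-reflexive (+-comm F _)))
  mirrored : ∀ i → i + suc k ≡ fib (1 + m) → fibCoeff m (F + k) ≡ xLimitCoeff i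
  mirrored zero    eq = fibCoeff-vanish m (≤-reflexive (trans (cong (_+ F) (sym eq)) (cong suc (+-comm k F))))
  mirrored (suc a) eq = begin
    fibCoeff m (F + k)   ≡⟨ fibCoeff-palindrome m (trans (rearrange a F k) (cong (_+ F) eq)) ⟨
    fibCoeff m a         ≡⟨ fibCoeff-stable m (≤-trans (1+i+k≡n⇒i<n eq) (fib-≤-suc (1 + m))) ⟩
    limitCoeff a         ∎
    where
    rearrange : ∀ a F k → 2 + a + (F + k) ≡ (suc a + suc k) + F
    rearrange = solve-∀

bridge : ℕ → ℕ → Group
bridge a b = a ∷ a + b ∷ b ∷ []

expand : ℕ → Row → Row
expand p []       = []
expand p (g ∷ gs) = bridge p (firstE g) ∷ (midGroups g ++ expand (lastE g) gs)

lastEntry : ℕ → Row → ℕ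
lastEntry = foldl (λ _ → lastE)

expandBetween : ℕ → Row → ℕ → Row
expandBetween p gs q = expand p gs ++ bridge (lastEntry p gs) q ∷ []

go≡expandBetween : ∀ p gs → go p gs ≡ expandBetween p gs 0
go≡expandBetween p []       = refl
go≡expandBetween p (g ∷ gs) =
  trans (cong (λ r → bridge p (firstE g) ∷ (midGroups g ++ r)) (go≡expandBetween (lastE g) gs))
        (cong (bridge p (firstE g) ∷_) (sym (++-assoc (midGroups g) (expand (lastE g) gs) _)))

expand-++ : ∀ p A B → expand p (A ++ B) ≡ expand p A ++ expand (lastEntry p A) B
expand-++ p []      B = refl
expand-++ p (g ∷ A) B =
  trans (cong (λ r → bridge p (firstE g) ∷ (midGroups g ++ r)) (expand-++ (lastE g) A B))
        (cong (bridge p (firstE g) ∷_) (sym (++-assoc (midGroups g) (expand (lastE g) A) _)))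

lastEntry-++ : ∀ p A B → lastEntry p (A ++ B) ≡ lastEntry (lastEntry p A) B
lastEntry-++ = foldl-++ (λ _ → lastE)

++-assoc₄ : ∀ {A : Set} (a b c d : List A) → (a ++ b ++ c) ++ d ≡ a ++ b ++ c ++ d
++-assoc₄ a b c d = trans (++-assoc a (b ++ c) d) (cong (a ++_) (++-assoc b c d))

twice : ℕ → ℕ
twice zero    = zero
twice (suc m) = suc (suc (twice m))

-- What j steps of the construction grow out of a group x, y.  For even j it begins
-- with x and ends with y; for odd j it lies strictly between a group ending in x
-- and a group beginning with y.
segment : ℕ → ℕ → ℕ → Row
segment 0 x y = (x ∷ y ∷ []) ∷ []
segment 1 x y = []
segment 2 x y = bridge x y ∷ []
segment (suc (suc (suc j))) x y =
  segment (suc j) x (x + y) ++ segment j (x + y) (x + y) ++ segment (suc j) (x + y) y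

lastEntry-segment-even : ∀ m x y p → lastEntry p (segment (twice m) x y) ≡ y
lastEntry-segment-even 0             x y p = refl
lastEntry-segment-even 1             x y p = refl
lastEntry-segment-even (suc (suc m)) x y p = begin
  lastEntry p (A ++ B ++ C)                   ≡⟨ lastEntry-++ p A (B ++ C) ⟩
  lastEntry (lastEntry p A) (B ++ C)          ≡⟨ lastEntry-++ (lastEntry p A) B C ⟩
  lastEntry (lastEntry (lastEntry p A) B) C   ≡⟨ lastEntry-segment-even (suc m) (x + y) y _ ⟩
  y                                           ∎
  where
  A = segment (twice (suc m)) x (x + y)
  B = segment (suc (twice m)) (x + y) (x + y)
  C = segment (twice (suc m)) (x + y) y

expand-segment-even : ∀ m x y p R →
  expand p (segment (twice m) x y ++ R) ≡ bridge p x ∷ segment (suc (twice m)) x y ++ expand y R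
expand-segment-odd : ∀ m x y {R T} → (∀ p → expand p R ≡ bridge p y ∷ T) →
  expand x (segment (suc (twice m)) x y ++ R) ≡ segment (2 + twice m) x y ++ T
expandBetween-segment-odd : ∀ m x y →
  expandBetween x (segment (suc (twice m)) x y) y ≡ segment (2 + twice m) x y

expand-segment-even zero          x y p R = refl
expand-segment-even (suc zero)    x y p R = refl
expand-segment-even (suc (suc m)) x y p R = begin
  expand p ((A ++ B ++ C) ++ R)
    ≡⟨ cong (expand p) (++-assoc₄ A B C R) ⟩
  expand p (A ++ B ++ C ++ R)
    ≡⟨ expand-segment-even (suc m) x (x + y) p (B ++ C ++ R) ⟩
  bridge p x ∷ A′ ++ expand (x + y) (B ++ C ++ R)
    ≡⟨ cong (λ r → bridge p x ∷ A′ ++ r)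
            (expand-segment-odd m (x + y) (x + y) (λ q → expand-segment-even (suc m) (x + y) y q R)) ⟩
  bridge p x ∷ A′ ++ B′ ++ C′ ++ expand y R
    ≡⟨ cong (bridge p x ∷_) (++-assoc₄ A′ B′ C′ (expand y R)) ⟨
  bridge p x ∷ (A′ ++ B′ ++ C′) ++ expand y R
    ∎
  where
  A  = segment (twice (suc m)) x (x + y)
  B  = segment (suc (twice m)) (x + y) (x + y)
  C  = segment (twice (suc m)) (x + y) y
  A′ = segment (suc (twice (suc m))) x (x + y)
  B′ = segment (twice (suc m)) (x + y) (x + y)
  C′ = segment (suc (twice (suc m))) (x + y) y

expand-segment-odd m x y {R} {T} expand-R = begin
  expand x (S ++ R)                            ≡⟨ expand-++ x S R ⟩
  expand x S ++ expand (lastEntry x S) R       ≡⟨ cong (expand x S ++_) (expand-R (lastEntry x S)) ⟩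
  expand x S ++ bridge (lastEntry x S) y ∷ T   ≡⟨ ++-assoc (expand x S) (bridge (lastEntry x S) y ∷ []) T ⟨
  expandBetween x S y ++ T                     ≡⟨ cong (_++ T) (expandBetween-segment-odd m x y) ⟩
  segment (2 + twice m) x y ++ T               ∎
  where S = segment (suc (twice m)) x y

expandBetween-segment-odd zero    x y = refl
expandBetween-segment-odd (suc m) x y = begin
  expand x (A ++ B ++ C) ++ bridge (lastEntry x (A ++ B ++ C)) y ∷ []
    ≡⟨ cong₂ (λ r l → r ++ bridge l y ∷ []) expand-ABC lastEntry-ABC ⟩
  (A′ ++ B′ ++ expand (x + y) C) ++ bridge (lastEntry (x + y) C) y ∷ []
    ≡⟨ ++-assoc₄ A′ B′ (expand (x + y) C) _ ⟩
  A′ ++ B′ ++ expandBetween (x + y) C y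
    ≡⟨ cong (λ r → A′ ++ B′ ++ r) (expandBetween-segment-odd m (x + y) y) ⟩
  A′ ++ B′ ++ C′
    ∎
  where
  A  = segment (suc (twice m)) x (x + y)
  B  = segment (twice m) (x + y) (x + y)
  C  = segment (suc (twice m)) (x + y) y
  A′ = segment (2 + twice m) x (x + y)
  B′ = segment (suc (twice m)) (x + y) (x + y)
  C′ = segment (2 + twice m) (x + y) y
  expand-ABC : expand x (A ++ B ++ C) ≡ A′ ++ B′ ++ expand (x + y) C
  expand-ABC = expand-segment-odd m x (x + y) (λ q → expand-segment-even m (x + y) (x + y) q C)
  lastEntry-ABC : lastEntry x (A ++ B ++ C) ≡ lastEntry (x + y) C
  lastEntry-ABC = begin
    lastEntry x (A ++ B ++ C)                   ≡⟨ lastEntry-++ x A (B ++ C) ⟩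
    lastEntry (lastEntry x A) (B ++ C)          ≡⟨ lastEntry-++ (lastEntry x A) B C ⟩
    lastEntry (lastEntry (lastEntry x A) B) C
      ≡⟨ cong (λ l → lastEntry l C) (lastEntry-segment-even m (x + y) (x + y) _) ⟩
    lastEntry (x + y) C                         ∎

segments : List ℕ → Row
segments = concatMap (λ j → segment j 1 1)

data EvenFirst : List ℕ → Set
data OddFirst  : List ℕ → Set

data EvenFirst where
  done : ∀ m → EvenFirst (twice m ∷ [])
  even : ∀ m {js} → OddFirst js → EvenFirst (twice m ∷ js)

data OddFirst where
  odd : ∀ m {js} → EvenFirst js → OddFirst (suc (twice m) ∷ js)

evenFirst-shift : ∀ {js} → EvenFirst js → OddFirst (map suc js ++ 0 ∷ [])
oddFirst-shift  : ∀ {js} → OddFirst js → EvenFirst (map suc js ++ 0 ∷ [])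
evenFirst-shift (done m)   = odd m (done 0)
evenFirst-shift (even m o) = odd m (oddFirst-shift o)
oddFirst-shift  (odd m e)  = even (suc m) (evenFirst-shift e)

expand-segments-evenFirst : ∀ {js} → EvenFirst js → ∀ p R →
  expand p (segments js ++ R) ≡ bridge p 1 ∷ segments (map suc js) ++ expand 1 R
expand-segments-oddFirst : ∀ {js} → OddFirst js → ∀ R →
  expand 1 (segments js ++ R) ≡ segments (map suc js) ++ expand 1 R

expand-segments-evenFirst (done m) p R = begin
  expand p ((S ++ []) ++ R)               ≡⟨ cong (expand p) (++-assoc S [] R) ⟩
  expand p (S ++ R)                       ≡⟨ expand-segment-even m 1 1 p R ⟩
  bridge p 1 ∷ S′ ++ expand 1 R           ≡⟨ cong (bridge p 1 ∷_) (++-assoc S′ [] (expand 1 R)) ⟨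
  bridge p 1 ∷ (S′ ++ []) ++ expand 1 R   ∎
  where
  S  = segment (twice m) 1 1
  S′ = segment (suc (twice m)) 1 1
expand-segments-evenFirst (even m {js} o) p R = begin
  expand p ((S ++ segments js) ++ R)
    ≡⟨ cong (expand p) (++-assoc S (segments js) R) ⟩
  expand p (S ++ segments js ++ R)
    ≡⟨ expand-segment-even m 1 1 p (segments js ++ R) ⟩
  bridge p 1 ∷ S′ ++ expand 1 (segments js ++ R)
    ≡⟨ cong (λ r → bridge p 1 ∷ S′ ++ r) (expand-segments-oddFirst o R) ⟩
  bridge p 1 ∷ S′ ++ segments (map suc js) ++ expand 1 R
    ≡⟨ cong (bridge p 1 ∷_) (++-assoc S′ _ (expand 1 R)) ⟨
  bridge p 1 ∷ (S′ ++ segments (map suc js)) ++ expand 1 R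
    ∎
  where
  S  = segment (twice m) 1 1
  S′ = segment (suc (twice m)) 1 1

expand-segments-oddFirst (odd m {js} e) R = begin
  expand 1 ((S ++ segments js) ++ R)
    ≡⟨ cong (expand 1) (++-assoc S (segments js) R) ⟩
  expand 1 (S ++ segments js ++ R)
    ≡⟨ expand-segment-odd m 1 1 (λ q → expand-segments-evenFirst e q R) ⟩
  S′ ++ segments (map suc js) ++ expand 1 R
    ≡⟨ ++-assoc S′ _ (expand 1 R) ⟨
  (S′ ++ segments (map suc js)) ++ expand 1 R
    ∎
  where
  S  = segment (suc (twice m)) 1 1
  S′ = segment (2 + twice m) 1 1

lastEntry-segments-evenFirst : ∀ {js} → EvenFirst js → ∀ p → lastEntry p (segments js) ≡ 1
lastEntry-segments-evenFirst (done m) p =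
  trans (lastEntry-++ p (segment (twice m) 1 1) []) (lastEntry-segment-even m 1 1 p)
lastEntry-segments-evenFirst (even m {_ ∷ js} (odd m′ e)) p = begin
  lastEntry p (S ++ S₁ ++ segments js)                     ≡⟨ lastEntry-++ p S (S₁ ++ segments js) ⟩
  lastEntry (lastEntry p S) (S₁ ++ segments js)            ≡⟨ lastEntry-++ (lastEntry p S) S₁ (segments js) ⟩
  lastEntry (lastEntry (lastEntry p S) S₁) (segments js)   ≡⟨ lastEntry-segments-evenFirst e _ ⟩
  1                                                        ∎
  where
  S  = segment (twice m) 1 1
  S₁ = segment (suc (twice m′)) 1 1

trimLast-snoc : ∀ g M h → trimLast (g ∷ M ++ h ∷ []) ≡ g ∷ M ++ dropLast h ∷ []
trimLast-snoc g []      h = refl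
trimLast-snoc g (x ∷ M) h = cong (g ∷_) (trimLast-snoc x M h)

nextRow-segments : ∀ {js} → EvenFirst js → nextRow (segments js) ≡ segments (0 ∷ map suc js ++ 0 ∷ [])
nextRow-segments {js} e = begin
  trim (go 0 S)
    ≡⟨ cong trim (go≡expandBetween 0 S) ⟩
  trim (expand 0 S ++ bridge (lastEntry 0 S) 0 ∷ [])
    ≡⟨ cong₂ (λ r l → trim (r ++ bridge l 0 ∷ [])) expand-S (lastEntry-segments-evenFirst e 0) ⟩
  trim ((bridge 0 1 ∷ segments (map suc js)) ++ bridge 1 0 ∷ [])
    ≡⟨ trimLast-snoc (1 ∷ 1 ∷ []) (segments (map suc js)) (bridge 1 0) ⟩
  (1 ∷ 1 ∷ []) ∷ segments (map suc js) ++ (1 ∷ 1 ∷ []) ∷ []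
    ≡⟨ cong ((1 ∷ 1 ∷ []) ∷_) (concatMap-++ (λ j → segment j 1 1) (map suc js) (0 ∷ [])) ⟨
  segments (0 ∷ map suc js ++ 0 ∷ [])
    ∎
  where
  S = segments js
  expand-S : expand 0 S ≡ bridge 0 1 ∷ segments (map suc js)
  expand-S = begin
    expand 0 S                                 ≡⟨ cong (expand 0) (++-identityʳ S) ⟨
    expand 0 (S ++ [])                         ≡⟨ expand-segments-evenFirst e 0 [] ⟩
    bridge 0 1 ∷ segments (map suc js) ++ []   ≡⟨ cong (bridge 0 1 ∷_) (++-identityʳ _) ⟩
    bridge 0 1 ∷ segments (map suc js)         ∎

rowIndices : ℕ → List ℕ
rowIndices n = upTo (suc n) ++ downFrom n

rowIndices-suc : ∀ n → rowIndices (suc n) ≡ 0 ∷ map suc (rowIndices n) ++ 0 ∷ []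
rowIndices-suc n = sym (begin
  0 ∷ map suc (U ++ D) ++ 0 ∷ []           ≡⟨ cong (λ l → 0 ∷ l ++ 0 ∷ []) (map-++ suc U D) ⟩
  0 ∷ (map suc U ++ map suc D) ++ 0 ∷ []   ≡⟨ cong (0 ∷_) (++-assoc (map suc U) (map suc D) _) ⟩
  0 ∷ map suc U ++ map suc D ++ 0 ∷ []     ≡⟨ cong₂ _++_ U-suc D-suc ⟩
  upTo (2 + n) ++ downFrom (suc n)         ∎)
  where
  U = upTo (suc n)
  D = downFrom n
  U-suc : 0 ∷ map suc U ≡ upTo (2 + n)
  U-suc = cong (0 ∷_) (map-applyUpTo (λ i → i) suc (suc n))
  D-suc : map suc D ++ 0 ∷ [] ≡ downFrom (suc n)
  D-suc = trans (cong (_++ 0 ∷ []) (map-applyDownFrom (λ i → i) suc n)) (applyDownFrom-∷ʳ (λ i → i) n)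

evenFirst-rowIndices : ∀ n → EvenFirst (rowIndices n)
evenFirst-rowIndices zero    = done 0
evenFirst-rowIndices (suc n) =
  subst EvenFirst (sym (rowIndices-suc n)) (even 0 (evenFirst-shift (evenFirst-rowIndices n)))

row≡segments : ∀ n → row (suc n) ≡ segments (rowIndices n)
row≡segments zero    = refl
row≡segments (suc n) = begin
  nextRow (row (suc n))                             ≡⟨ cong nextRow (row≡segments n) ⟩
  nextRow (segments (rowIndices n))                 ≡⟨ nextRow-segments (evenFirst-rowIndices n) ⟩
  segments (0 ∷ map suc (rowIndices n) ++ 0 ∷ [])   ≡⟨ cong segments (rowIndices-suc n) ⟨
  segments (rowIndices (suc n))                     ∎

-- The entries of segment j x y, including the boundary value x and excluding y.
segmentEntries : ℕ → ℕ → ℕ → List ℕ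
segmentEntries 0 x y = x ∷ []
segmentEntries 1 x y = x ∷ []
segmentEntries 2 x y = x ∷ x + y ∷ []
segmentEntries (suc (suc (suc j))) x y =
  segmentEntries (suc j) x (x + y) ++ segmentEntries j (x + y) (x + y) ++ segmentEntries (suc j) (x + y) y

concat-segment-even : ∀ m x y → concat (segment (twice m) x y) ≡ segmentEntries (twice m) x y ++ y ∷ []
concat-segment-odd  : ∀ m x y → x ∷ concat (segment (suc (twice m)) x y) ≡ segmentEntries (suc (twice m)) x y

concat-segment-even 0             x y = refl
concat-segment-even 1             x y = refl
concat-segment-even (suc (suc m)) x y = begin
  concat (A ++ B ++ C)
    ≡⟨ concat-++ A (B ++ C) ⟨
  concat A ++ concat (B ++ C)
    ≡⟨ cong₂ _++_ (concat-segment-even (suc m) x (x + y)) (sym (concat-++ B C)) ⟩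
  (a ++ x + y ∷ []) ++ concat B ++ concat C
    ≡⟨ ++-assoc a (x + y ∷ []) _ ⟩
  a ++ (x + y ∷ concat B) ++ concat C
    ≡⟨ cong₂ (λ u v → a ++ u ++ v) (concat-segment-odd m (x + y) (x + y))
                                    (concat-segment-even (suc m) (x + y) y) ⟩
  a ++ b ++ c ++ y ∷ []
    ≡⟨ ++-assoc₄ a b c (y ∷ []) ⟨
  (a ++ b ++ c) ++ y ∷ []
    ∎
  where
  A = segment (twice (suc m)) x (x + y)
  B = segment (suc (twice m)) (x + y) (x + y)
  C = segment (twice (suc m)) (x + y) y
  a = segmentEntries (twice (suc m)) x (x + y)
  b = segmentEntries (suc (twice m)) (x + y) (x + y)
  c = segmentEntries (twice (suc m)) (x + y) y

concat-segment-odd zero    x y = refl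
concat-segment-odd (suc m) x y = begin
  x ∷ concat (A ++ B ++ C)
    ≡⟨ cong (x ∷_) (concat-++ A (B ++ C)) ⟨
  (x ∷ concat A) ++ concat (B ++ C)
    ≡⟨ cong₂ _++_ (concat-segment-odd m x (x + y)) (sym (concat-++ B C)) ⟩
  a ++ concat B ++ concat C
    ≡⟨ cong (λ u → a ++ u ++ concat C) (concat-segment-even m (x + y) (x + y)) ⟩
  a ++ (b ++ x + y ∷ []) ++ concat C
    ≡⟨ cong (a ++_) (++-assoc b (x + y ∷ []) _) ⟩
  a ++ b ++ (x + y ∷ concat C)
    ≡⟨ cong (λ u → a ++ b ++ u) (concat-segment-odd m (x + y) y) ⟩
  a ++ b ++ c
    ∎
  where
  A = segment (suc (twice m)) x (x + y)
  B = segment (twice m) (x + y) (x + y)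
  C = segment (suc (twice m)) (x + y) y
  a = segmentEntries (suc (twice m)) x (x + y)
  b = segmentEntries (twice m) (x + y) (x + y)
  c = segmentEntries (suc (twice m)) (x + y) y

length-segmentEntries : ∀ j x y → length (segmentEntries j x y) ≡ fib (suc j)
length-segmentEntries 0 x y = refl
length-segmentEntries 1 x y = refl
length-segmentEntries 2 x y = refl
length-segmentEntries (suc (suc (suc j))) x y = begin
  length (a ++ b ++ c)               ≡⟨ length-++ a ⟩
  length a + length (b ++ c)         ≡⟨ cong (length a +_) (length-++ b) ⟩
  length a + (length b + length c)   ≡⟨ cong₂ _+_ (length-segmentEntries (suc j) x (x + y))
                                                  (cong₂ _+_ (length-segmentEntries j (x + y) (x + y))
                                                             (length-segmentEntries (suc j) (x + y) y)) ⟩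
  fib (2 + j) + (fib (1 + j) + fib (2 + j)) ∎
  where
  a = segmentEntries (suc j) x (x + y)
  b = segmentEntries j (x + y) (x + y)
  c = segmentEntries (suc j) (x + y) y

x*1+y*0≡x : ∀ x y → x * 1 + y * 0 ≡ x
x*1+y*0≡x = solve-∀

SegmentEntriesFormula : ℕ → Set
SegmentEntriesFormula j = ∀ x y {i k} → suc i + k ≡ fib (suc j) →
                          coeff (segmentEntries j x y) k ≡ x * limitCoeff i + y * xLimitCoeff k

segmentEntriesFormula-step : ∀ j → SegmentEntriesFormula (suc j) → SegmentEntriesFormula j →
                             SegmentEntriesFormula (3 + j)
segmentEntriesFormula-step j formula₁ formula₀ x y {i} {k} eq with split (fib (2 + j)) k
... | below a ea = begin
  coeff (A ++ _) k
    ≡⟨ coeff-++ˡ A _ (length-segmentEntries (suc j) x (x + y)) (1+i+k≡n⇒k<n ea) ⟩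
  coeff A k
    ≡⟨ formula₁ x (x + y) ea ⟩
  x * limitCoeff a + (x + y) * xLimitCoeff k
    ≡⟨ regroup x y (limitCoeff a) (xLimitCoeff k) ⟩
  x * (xLimitCoeff k + limitCoeff a) + y * xLimitCoeff k
    ≡⟨ cong (λ t → x * t + y * xLimitCoeff k) i-split ⟨
  x * limitCoeff i + y * xLimitCoeff k
    ∎
  where
  A = segmentEntries (suc j) x (x + y)
  G = fib (3 + j)
  regroup : ∀ x y u v → x * u + (x + y) * v ≡ x * (v + u) + y * v
  regroup = solve-∀
  rearrange : ∀ a k G → (suc a + k) + G ≡ (G + suc a) + k
  rearrange = solve-∀
  1+i≡G+1+a : suc i ≡ G + suc a
  1+i≡G+1+a = +-cancelʳ-≡ k _ _ (trans eq (trans (cong (_+ G) (sym ea)) (rearrange a k G)))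
  i-split : limitCoeff i ≡ xLimitCoeff k + limitCoeff a
  i-split = trans (cong xLimitCoeff 1+i≡G+1+a) (xLimitCoeff-split (suc j) (trans (+-comm k (suc a)) ea))
... | above r refl with split (fib (1 + j)) r
...   | below b eb = begin
  coeff (A ++ B ++ _) (F + r)
    ≡⟨ coeff-++ʳ A (B ++ _) (length-segmentEntries (suc j) x (x + y)) r ⟩
  coeff (B ++ _) r
    ≡⟨ coeff-++ˡ B _ (length-segmentEntries j (x + y) (x + y)) (1+i+k≡n⇒k<n eb) ⟩
  coeff B r
    ≡⟨ formula₀ (x + y) (x + y) eb ⟩
  (x + y) * limitCoeff b + (x + y) * xLimitCoeff r
    ≡⟨ regroup x y (limitCoeff b) (xLimitCoeff r) ⟩
  x * (xLimitCoeff r + limitCoeff b) + y * (limitCoeff b + xLimitCoeff r)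
    ≡⟨ cong₂ (λ u v → x * u + y * v) i-split (xLimitCoeff-split j eb) ⟨
  x * limitCoeff i + y * xLimitCoeff (F + r)
    ∎
  where
  F = fib (2 + j)
  A = segmentEntries (suc j) x (x + y)
  B = segmentEntries j (x + y) (x + y)
  regroup : ∀ x y u v → (x + y) * u + (x + y) * v ≡ x * (v + u) + y * (u + v)
  regroup = solve-∀
  rearrange : ∀ F b r → (F + suc b) + (F + r) ≡ F + ((suc b + r) + F)
  rearrange = solve-∀
  1+i≡F+1+b : suc i ≡ F + suc b
  1+i≡F+1+b = +-cancelʳ-≡ (F + r) _ _ (trans eq (sym (trans (rearrange F b r) (cong (λ t → F + (t + F)) eb))))
  i-split : limitCoeff i ≡ xLimitCoeff r + limitCoeff b
  i-split = trans (cong xLimitCoeff 1+i≡F+1+b) (xLimitCoeff-split j (trans (+-comm r (suc b)) eb))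
...   | above s refl = begin
  coeff (A ++ B ++ C) (F + (F₁ + s))
    ≡⟨ coeff-++ʳ A (B ++ C) (length-segmentEntries (suc j) x (x + y)) (F₁ + s) ⟩
  coeff (B ++ C) (F₁ + s)
    ≡⟨ coeff-++ʳ B C (length-segmentEntries j (x + y) (x + y)) s ⟩
  coeff C s
    ≡⟨ formula₁ (x + y) y 1+i+s≡F ⟩
  (x + y) * limitCoeff i + y * xLimitCoeff s
    ≡⟨ regroup x y (limitCoeff i) (xLimitCoeff s) ⟩
  x * limitCoeff i + y * (limitCoeff i + xLimitCoeff s)
    ≡⟨ cong (λ t → x * limitCoeff i + y * t) k-split ⟨
  x * limitCoeff i + y * xLimitCoeff (F + (F₁ + s))
    ∎
  where
  F  = fib (2 + j)
  F₁ = fib (1 + j)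
  A  = segmentEntries (suc j) x (x + y)
  B  = segmentEntries j (x + y) (x + y)
  C  = segmentEntries (suc j) (x + y) y
  regroup : ∀ x y u v → (x + y) * u + y * v ≡ x * u + y * (u + v)
  regroup = solve-∀
  rearrangeˡ : ∀ i s F F₁ → (suc i + s) + (F₁ + F) ≡ suc i + (F + (F₁ + s))
  rearrangeˡ = solve-∀
  rearrangeʳ : ∀ F F₁ s → F + (F₁ + s) ≡ (F₁ + F) + s
  rearrangeʳ = solve-∀
  1+i+s≡F : suc i + s ≡ F
  1+i+s≡F = +-cancelʳ-≡ (F₁ + F) _ _ (trans (rearrangeˡ i s F F₁) eq)
  k-split : xLimitCoeff (F + (F₁ + s)) ≡ limitCoeff i + xLimitCoeff s
  k-split = trans (cong xLimitCoeff (rearrangeʳ F F₁ s)) (xLimitCoeff-split (suc j) 1+i+s≡F)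

coeff-segmentEntries : ∀ j → SegmentEntriesFormula j
coeff-segmentEntries 0 x y {zero}  {zero}  _  = sym (x*1+y*0≡x x y)
coeff-segmentEntries 0 x y {zero}  {suc k} ()
coeff-segmentEntries 0 x y {suc i} {k}     ()
coeff-segmentEntries 1 x y {zero}  {zero}  _  = sym (x*1+y*0≡x x y)
coeff-segmentEntries 1 x y {zero}  {suc k} ()
coeff-segmentEntries 1 x y {suc i} {k}     ()
coeff-segmentEntries 2 x y {zero}        {zero}        ()
coeff-segmentEntries 2 x y {zero}        {suc zero}    _  = sym (cong₂ _+_ (*-identityʳ x) (*-identityʳ y))
coeff-segmentEntries 2 x y {zero}        {suc (suc k)} ()
coeff-segmentEntries 2 x y {suc zero}    {zero}        _  = sym (x*1+y*0≡x x y)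
coeff-segmentEntries 2 x y {suc zero}    {suc k}       ()
coeff-segmentEntries 2 x y {suc (suc i)} {k}           ()
coeff-segmentEntries (suc (suc (suc j))) =
  segmentEntriesFormula-step j (coeff-segmentEntries (suc j)) (coeff-segmentEntries j)

coeff-segmentEntries-unit : ∀ j {k} → k < fib (suc j) →
                            coeff (segmentEntries j 1 1) k ≡ xLimitCoeff (fib (2 + j) + k)
coeff-segmentEntries-unit j {k} k<F with m≤n⇒∃[o]m+o≡n k<F
... | i , 1+k+i≡F = begin
  coeff (segmentEntries j 1 1) k         ≡⟨ coeff-segmentEntries j 1 1 1+i+k≡F ⟩
  1 * limitCoeff i + 1 * xLimitCoeff k   ≡⟨ cong₂ _+_ (*-identityˡ _) (*-identityˡ (xLimitCoeff k)) ⟩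
  xLimitCoeff (suc i) + xLimitCoeff k    ≡⟨ xLimitCoeff-split j 1+i+k≡F ⟨
  xLimitCoeff (fib (2 + j) + k)          ∎
  where
  1+i+k≡F : suc i + k ≡ fib (suc j)
  1+i+k≡F = trans (cong suc (+-comm i k)) 1+k+i≡F

segmentsEntries : List ℕ → List ℕ
segmentsEntries = concatMap (λ j → segmentEntries j 1 1)

concat-segments-evenFirst : ∀ {js} → EvenFirst js → concat (segments js) ≡ segmentsEntries js ++ 1 ∷ []
concat-segments-oddFirst  : ∀ {js} → OddFirst js → 1 ∷ concat (segments js) ≡ segmentsEntries js ++ 1 ∷ []

concat-segments-evenFirst (done m) = begin
  concat (S ++ [])      ≡⟨ cong concat (++-identityʳ S) ⟩
  concat S              ≡⟨ concat-segment-even m 1 1 ⟩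
  s ++ 1 ∷ []           ≡⟨ cong (_++ 1 ∷ []) (++-identityʳ s) ⟨
  (s ++ []) ++ 1 ∷ []   ∎
  where
  S = segment (twice m) 1 1
  s = segmentEntries (twice m) 1 1
concat-segments-evenFirst (even m {js} o) = begin
  concat (S ++ segments js)               ≡⟨ concat-++ S (segments js) ⟨
  concat S ++ concat (segments js)        ≡⟨ cong (_++ concat (segments js)) (concat-segment-even m 1 1) ⟩
  (s ++ 1 ∷ []) ++ concat (segments js)   ≡⟨ ++-assoc s (1 ∷ []) _ ⟩
  s ++ 1 ∷ concat (segments js)           ≡⟨ cong (s ++_) (concat-segments-oddFirst o) ⟩
  s ++ segmentsEntries js ++ 1 ∷ []       ≡⟨ ++-assoc s (segmentsEntries js) _ ⟨
  (s ++ segmentsEntries js) ++ 1 ∷ []     ∎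
  where
  S = segment (twice m) 1 1
  s = segmentEntries (twice m) 1 1

concat-segments-oddFirst (odd m {js} e) = begin
  1 ∷ concat (S ++ segments js)            ≡⟨ cong (1 ∷_) (concat-++ S (segments js)) ⟨
  (1 ∷ concat S) ++ concat (segments js)   ≡⟨ cong₂ _++_ (concat-segment-odd m 1 1)
                                                          (concat-segments-evenFirst e) ⟩
  s ++ segmentsEntries js ++ 1 ∷ []        ≡⟨ ++-assoc s (segmentsEntries js) _ ⟨
  (s ++ segmentsEntries js) ++ 1 ∷ []      ∎
  where
  S = segment (suc (twice m)) 1 1
  s = segmentEntries (suc (twice m)) 1 1

prefix : ℕ → List ℕ
prefix zero    = []
prefix (suc n) = prefix n ++ segmentEntries n 1 1

suffix : ℕ → List ℕ
suffix zero    = 1 ∷ []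
suffix (suc n) = segmentEntries n 1 1 ++ suffix n

segmentsEntries-upTo : ∀ n → segmentsEntries (upTo n) ≡ prefix n
segmentsEntries-upTo zero    = refl
segmentsEntries-upTo (suc n) = begin
  segmentsEntries (upTo (suc n))
    ≡⟨ cong segmentsEntries (applyUpTo-∷ʳ (λ i → i) n) ⟨
  segmentsEntries (upTo n ++ n ∷ [])
    ≡⟨ concatMap-++ (λ j → segmentEntries j 1 1) (upTo n) (n ∷ []) ⟩
  segmentsEntries (upTo n) ++ segmentEntries n 1 1 ++ []
    ≡⟨ cong₂ _++_ (segmentsEntries-upTo n) (++-identityʳ _) ⟩
  prefix n ++ segmentEntries n 1 1
    ∎

segmentsEntries-downFrom : ∀ n → segmentsEntries (downFrom n) ++ 1 ∷ [] ≡ suffix n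
segmentsEntries-downFrom zero    = refl
segmentsEntries-downFrom (suc n) =
  trans (++-assoc (segmentEntries n 1 1) _ _) (cong (segmentEntries n 1 1 ++_) (segmentsEntries-downFrom n))

concat-row : ∀ n → concat (row (suc n)) ≡ prefix (suc n) ++ suffix n
concat-row n = begin
  concat (row (suc n))
    ≡⟨ cong concat (row≡segments n) ⟩
  concat (segments (rowIndices n))
    ≡⟨ concat-segments-evenFirst (evenFirst-rowIndices n) ⟩
  segmentsEntries (U ++ D) ++ 1 ∷ []
    ≡⟨ cong (_++ 1 ∷ []) (concatMap-++ (λ j → segmentEntries j 1 1) U D) ⟩
  (segmentsEntries U ++ segmentsEntries D) ++ 1 ∷ []
    ≡⟨ ++-assoc (segmentsEntries U) _ _ ⟩
  segmentsEntries U ++ segmentsEntries D ++ 1 ∷ []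
    ≡⟨ cong₂ _++_ (segmentsEntries-upTo (suc n)) (segmentsEntries-downFrom n) ⟩
  prefix (suc n) ++ suffix n
    ∎
  where
  U = upTo (suc n)
  D = downFrom n

length-prefix : ∀ n → suc (length (prefix n)) ≡ fib (2 + n)
length-prefix zero    = refl
length-prefix (suc n) = begin
  suc (length (prefix n ++ segmentEntries n 1 1))
    ≡⟨ cong suc (length-++ (prefix n)) ⟩
  suc (length (prefix n)) + length (segmentEntries n 1 1)
    ≡⟨ cong₂ _+_ (length-prefix n) (length-segmentEntries n 1 1) ⟩
  fib (2 + n) + fib (1 + n)
    ≡⟨ +-comm (fib (2 + n)) _ ⟩
  fib (3 + n)
    ∎

coeff-prefix : ∀ n {k} → k < length (prefix n) → coeff (prefix n) k ≡ limitCoeff k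
coeff-prefix (suc n) {k} k<P with split (length (prefix n)) k
... | below _ eq = trans (coeff-++ˡ (prefix n) _ refl (1+i+k≡n⇒k<n eq)) (coeff-prefix n (1+i+k≡n⇒k<n eq))
... | above r refl = begin
  coeff (prefix n ++ segmentEntries n 1 1) (length (prefix n) + r)
    ≡⟨ coeff-++ʳ (prefix n) _ refl r ⟩
  coeff (segmentEntries n 1 1) r
    ≡⟨ coeff-segmentEntries-unit n r<F ⟩
  xLimitCoeff (fib (2 + n) + r)
    ≡⟨ cong (λ t → xLimitCoeff (t + r)) (length-prefix n) ⟨
  limitCoeff (length (prefix n) + r)
    ∎
  where
  r<F : r < fib (1 + n)
  r<F = ≤-trans (+-cancelˡ-< (length (prefix n)) r _ (≤-trans k<P (≤-reflexive (length-++ (prefix n)))))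
                (≤-reflexive (length-segmentEntries n 1 1))

coeff-prefix-++-suffix : ∀ n k → coeff (prefix (suc n) ++ suffix n) k ≡ fibCoeff (suc n) k
coeff-prefix-++-suffix zero    k = refl
coeff-prefix-++-suffix (suc n) k with split (length (prefix (2 + n))) k
... | below _ eq = begin
  coeff (prefix (2 + n) ++ suffix (suc n)) k   ≡⟨ coeff-++ˡ (prefix (2 + n)) _ refl (1+i+k≡n⇒k<n eq) ⟩
  coeff (prefix (2 + n)) k                     ≡⟨ coeff-prefix (2 + n) (1+i+k≡n⇒k<n eq) ⟩
  limitCoeff k                                 ≡⟨ fibCoeff-stable (2 + n) k<F ⟨
  fibCoeff (2 + n) k                           ∎
  where
  k<F : k < fib (4 + n)
  k<F = <-trans (1+i+k≡n⇒k<n eq) (≤-reflexive (length-prefix (2 + n)))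
... | above r refl = begin
  coeff (P₂ ++ suffix (suc n)) (length P₂ + r)
    ≡⟨ coeff-++ʳ P₂ _ refl r ⟩
  coeff (suffix (suc n)) r
    ≡⟨ coeff-++ʳ P (suffix (suc n)) refl r ⟨
  coeff (P ++ suffix (suc n)) (length P + r)
    ≡⟨ cong (λ l → coeff l (length P + r)) (++-assoc P (segmentEntries n 1 1) (suffix n)) ⟨
  coeff (prefix (suc n) ++ suffix n) (length P + r)
    ≡⟨ coeff-prefix-++-suffix n (length P + r) ⟩
  fibCoeff (suc n) (length P + r)
    ≡⟨ cong (_+ fibCoeff (suc n) (length P + r)) (fibCoeff-vanish (suc n) F≤1+G+P+r) ⟨
  fibCoeff (suc n) (G + (length P + r)) + fibCoeff (suc n) (length P + r)
    ≡⟨ fibCoeff-suc-+ (suc n) (length P + r) ⟨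
  fibCoeff (2 + n) (G + (length P + r))
    ≡⟨ cong (fibCoeff (2 + n)) (trans (sym (+-assoc G (length P) r)) (cong (_+ r) (sym length-P₂))) ⟩
  fibCoeff (2 + n) (length P₂ + r)
    ∎
  where
  P  = prefix n
  P₂ = prefix (2 + n)
  G  = fib (3 + n)
  length-P₂ : length P₂ ≡ G + length P
  length-P₂ = suc-injective (begin
    suc (length P₂)      ≡⟨ length-prefix (2 + n) ⟩
    fib (2 + n) + G      ≡⟨ cong (_+ G) (length-prefix n) ⟨
    suc (length P) + G   ≡⟨ cong suc (+-comm (length P) G) ⟩
    suc (G + length P)   ∎)
  F≤1+G+P+r : fib (4 + n) ≤ suc (G + (length P + r))
  F≤1+G+P+r = ≤-trans (≤-reflexive (cong (_+ G) (sym (length-prefix n))))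
                      (s≤s (≤-trans (≤-reflexive (+-comm (length P) G)) (+-monoʳ-≤ G (m≤m+n (length P) r))))

theorem3 : (n : ℕ) → 1 ≤ n → (k : ℕ) → entry n k ≡ coeff (fibProd n) k
theorem3 (suc n) _ k = begin
  coeff (concat (row (suc n))) k         ≡⟨ cong (λ l → coeff l k) (concat-row n) ⟩
  coeff (prefix (suc n) ++ suffix n) k   ≡⟨ coeff-prefix-++-suffix n k ⟩
  coeff (fibProd (suc n)) k              ∎
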